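{- Let $2\le s\le t$ be integers. There exist a constant $c_s\in(0,1]$ depending only on $s$ and a constant $C>0$ depending only on $s,t$ such that for every $N\ge1$ and every $K_{s,t}$-free set $A\subseteq[N]=\{1,\dots,N\}$, \[ E_s(1_A,1_{ -A})\le t|A|^s+C|A|^{s-c_s}. \]
   Context: A set $A\subseteq\mathbb{Z}$ is $K_{s,t}$-free if there do not exist pairwise distinct integers $x_1,\dots,x_s$ and pairwise distinct integers $y_1,\dots,y_t$ with $x_i+y_j\in A$ for all $i,j$. For finitely supported $f,g:\mathbb{Z}\to\mathbb{R}$, $(f*g)(x)=\sum_{y}f(y)g(x-y)$ and $E_m(f,g)=\sum_{n\in\mathbb{Z}}((f*g)(n))^m$; $1_A$, $1_{ -A}$ are the indicator functions of $A$ and $-A=\{ -a:a\in A\}$, so $E_s(1_A,1_{ -A})=\sum_{d\in\mathbb{Z}}\#\{(a,a')\in A^2:a-a'=d\}^s$. -}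

module Defs where

open import Data.Nat as ℕ using (ℕ; _^_)
open import Data.Integer as ℤ using (ℤ; +_; _-_)
open import Data.List using (List; map; upTo; length)
open import Data.Nat.ListAction using (sum)
open import Data.List.Membership.DecPropositional ℤ._≟_ using (_∈_; _∈?_)
open import Data.List.Relation.Unary.All using (All)
open import Data.List.Relation.Unary.Unique.Propositional using (Unique)
open import Data.Fin using (Fin)
open import Data.Product using (Σ; _×_)
open import Data.Bool using (if_then_else_)
open import Relation.Nullary using (¬_; does)
open import Relation.Binary.PropositionalEquality using (_≡_)
open import Function.Definitions using (Injective)

-- A finite set of integers is represented by a duplicate-free list.
-- Indicator function 1_A of a finite set A (given as a list).
𝟙 : List ℤ → ℤ → ℕ
𝟙 A x = if does (x ∈? A) then 1 else 0

𝟙⁻ : List ℤ → ℤ → ℕ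
𝟙⁻ A x = 𝟙 A (ℤ.- x)

-- Convolution (f * g)(x) = Σ_y f(y) g(x - y), where the list `suppf`
-- contains the (finite) support of f.
conv : (ℤ → ℕ) → (ℤ → ℕ) → List ℤ → ℤ → ℕ
conv f g suppf x = sum (map (λ y → f y ℕ.* g (x - y)) suppf)

-- E_m(f,g) = Σ_n ((f*g)(n))^m, where `suppf` contains the support of f
-- and `suppfg` contains the support of f * g.
E : ℕ → (ℤ → ℕ) → (ℤ → ℕ) → List ℤ → List ℤ → ℕ
E m f g suppf suppfg = sum (map (λ n → conv f g suppf n ^ m) suppfg)

-- The integers -N, ..., N (contains the support of 1_A * 1_{-A} for A ⊆ [N]).
symRange : ℕ → List ℤ
symRange N = map (λ k → + k - + N) (upTo (ℕ.suc (2 ℕ.* N)))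

Es : ℕ → ℕ → List ℤ → ℕ
Es s N A = E s (𝟙 A) (𝟙⁻ A) A (symRange N)

SubsetOfInterval : ℕ → List ℤ → Set
SubsetOfInterval N A = Unique A × All (λ a → (+ 1 ℤ.≤ a) × (a ℤ.≤ + N)) A

KstFree : ℕ → ℕ → List ℤ → Set
KstFree s t A =
  ¬ (Σ (Fin s → ℤ) λ x → Σ (Fin t → ℤ) λ y →
       Injective _≡_ _≡_ x × Injective _≡_ _≡_ y ×
       (∀ i j → (x i ℤ.+ y j) ∈ A))

{-# OPTIONS --safe #-}
-- Write r(d) = |A ∩ (A + d)|, so that E_k(1_A, 1_{-A}) = Σ_d r(d)^k, and expand r(d)^s as a sum over
-- s-tuples T of elements of A of [T ⊆ A + d]. A tuple of distinct elements lies in at most t − 1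
-- translates A + d, since t of them would span a copy of K_{s,t}; the tuples with a repeated entry
-- contribute at most C(s,2) r(d)^(s−1). Hence E_s ≤ (t − 1)|A|^s + C(s,2) E_{s−1}, and E_1 ≤ |A|²
-- already gives E_2 ≤ t|A|². For s ≥ 3, Cauchy–Schwarz gives E_{s−1}² ≤ E_{s−2} E_s ≤ |A|^(s−1) · O(|A|^s),
-- so the excess E_s − t|A|^s is O(|A|^(s − 1/2)), i.e. c_s = 1/2.
module Submission where

open import Defs
open import Data.Bool using (Bool; true; false; if_then_else_; _∧_; _∨_; not)
open import Data.Empty using (⊥-elim)
open import Data.Fin using (Fin; zero; suc)
open import Data.Integer as ℤ using (ℤ; _-_)
import Data.Integer.Properties as ℤₚ
import Data.Integer.Tactic.RingSolver as ℤ-Solver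
open import Data.List using (List; []; _∷_; map; length)
open import Data.List.Membership.DecPropositional ℤ._≟_ using (_∈_; _∈?_)
open import Data.List.Relation.Unary.All as All using (All; []; _∷_; all?)
open import Data.List.Relation.Unary.All.Properties.Core using (¬Any⇒All¬)
open import Data.List.Relation.Unary.Any using (here; there)
open import Data.List.Relation.Unary.AllPairs using (_∷_)
open import Data.List.Relation.Unary.Unique.Propositional using (Unique)
open import Data.List.Relation.Unary.Unique.DecPropositional ℤ._≟_ using (unique?)
import Data.List.Relation.Unary.Unique.Propositional.Properties as Uniqueₚ
open import Data.Nat using (ℕ; zero; suc; _+_; _*_; _^_; _∸_; _≤_; _<_; z≤n; s≤s; s≤s⁻¹; _≤?_)
open import Data.Nat.Combinatorics using (_C_; nC1≡n; nCk+nC[k+1]≡[n+1]C[k+1])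
open import Data.Nat.ListAction using (sum)
open import Data.Nat.Properties
open import Data.Nat.Tactic.RingSolver using (solve-∀)
open import Algebra.Properties.CommutativeSemigroup +-commutativeSemigroup
  using () renaming (interchange to +-interchange)
open import Data.Product using (Σ; _×_; _,_; proj₁; proj₂)
open import Data.Sum using (inj₁; inj₂)
open import Data.Unit using (tt)
open import Function.Definitions using (Injective)
open import Relation.Binary.PropositionalEquality
open import Relation.Nullary using (Dec; yes; no; ¬_; does)
open import Relation.Unary using (Decidable)

⟦_⟧ : Bool → ℕ
⟦ b ⟧ = if b then 1 else 0

⟦⟧≤1 : ∀ b → ⟦ b ⟧ ≤ 1
⟦⟧≤1 true  = ≤-refl
⟦⟧≤1 false = z≤n

⟦∨⟧≤⟦⟧+⟦⟧ : ∀ a b → ⟦ a ∨ b ⟧ ≤ ⟦ a ⟧ + ⟦ b ⟧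
⟦∨⟧≤⟦⟧+⟦⟧ true  b = s≤s z≤n
⟦∨⟧≤⟦⟧+⟦⟧ false b = ≤-refl

⟦∧⟧≡⟦⟧*⟦⟧ : ∀ a b → ⟦ a ∧ b ⟧ ≡ ⟦ a ⟧ * ⟦ b ⟧
⟦∧⟧≡⟦⟧*⟦⟧ true  b = sym (+-identityʳ ⟦ b ⟧)
⟦∧⟧≡⟦⟧*⟦⟧ false b = refl

⟦⟧+⟦not⟧≡1 : ∀ b → ⟦ b ⟧ + ⟦ not b ⟧ ≡ 1
⟦⟧+⟦not⟧≡1 true  = refl
⟦⟧+⟦not⟧≡1 false = refl

∑ : {X : Set} → List X → (X → ℕ) → ℕ
∑ L f = sum (map f L)

module _ {X : Set} where

  ∑-cong : ∀ (L : List X) {f g : X → ℕ} → f ≗ g → ∑ L f ≡ ∑ L g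
  ∑-cong []      f≗g = refl
  ∑-cong (x ∷ L) f≗g = cong₂ _+_ (f≗g x) (∑-cong L f≗g)

  ∑-cong-All : ∀ {L : List X} {f g : X → ℕ} → All (λ x → f x ≡ g x) L → ∑ L f ≡ ∑ L g
  ∑-cong-All []            = refl
  ∑-cong-All (fx≡gx ∷ eqs) = cong₂ _+_ fx≡gx (∑-cong-All eqs)

  ∑-mono : ∀ (L : List X) {f g : X → ℕ} → (∀ x → f x ≤ g x) → ∑ L f ≤ ∑ L g
  ∑-mono []      f≤g = z≤n
  ∑-mono (x ∷ L) f≤g = +-mono-≤ (f≤g x) (∑-mono L f≤g)

  ∑-distrib-+ : ∀ (L : List X) (f g : X → ℕ) → ∑ L (λ x → f x + g x) ≡ ∑ L f + ∑ L g
  ∑-distrib-+ []      f g = refl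
  ∑-distrib-+ (x ∷ L) f g =
    trans (cong (f x + g x +_) (∑-distrib-+ L f g)) (+-interchange (f x) (g x) _ _)

  ∑-*ˡ : ∀ (L : List X) c (f : X → ℕ) → ∑ L (λ x → c * f x) ≡ c * ∑ L f
  ∑-*ˡ []      c f = sym (*-zeroʳ c)
  ∑-*ˡ (x ∷ L) c f = trans (cong (c * f x +_) (∑-*ˡ L c f)) (sym (*-distribˡ-+ c (f x) _))

  ∑-*ʳ : ∀ (L : List X) c (f : X → ℕ) → ∑ L (λ x → f x * c) ≡ ∑ L f * c
  ∑-*ʳ []      c f = refl
  ∑-*ʳ (x ∷ L) c f = trans (cong (f x * c +_) (∑-*ʳ L c f)) (sym (*-distribʳ-+ c (f x) _))

  ∑-const : ∀ (L : List X) c → ∑ L (λ _ → c) ≡ length L * c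
  ∑-const []      c = refl
  ∑-const (x ∷ L) c = cong (c +_) (∑-const L c)

  ∑-zero : ∀ (L : List X) → ∑ L (λ _ → 0) ≡ 0
  ∑-zero L = trans (∑-const L 0) (*-zeroʳ (length L))

  ∑-⟦⟧≤length : ∀ (L : List X) (b : X → Bool) → ∑ L (λ x → ⟦ b x ⟧) ≤ length L
  ∑-⟦⟧≤length []      b = z≤n
  ∑-⟦⟧≤length (x ∷ L) b = +-mono-≤ (⟦⟧≤1 (b x)) (∑-⟦⟧≤length L b)

∑-comm : ∀ {X Y : Set} (L : List X) (M : List Y) (f : X → Y → ℕ) →
  ∑ L (λ x → ∑ M (f x)) ≡ ∑ M (λ y → ∑ L (λ x → f x y))
∑-comm []      M f = sym (∑-zero M)
∑-comm (x ∷ L) M f =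
  trans (cong (∑ M (f x) +_) (∑-comm L M f)) (sym (∑-distrib-+ M (f x) _))

module CauchySchwarz where

  square-cancel : ∀ a b → a * a ≤ b * b → a ≤ b
  square-cancel a b a²≤b² with a ≤? b
  ... | yes a≤b = a≤b
  ... | no  a≰b = ⊥-elim (<⇒≱ (*-mono-< (≰⇒> a≰b) (≰⇒> a≰b)) a²≤b²)

  am-gm-ordered : ∀ {a b} → a ≤ b → 4 * (a * b) ≤ (a + b) * (a + b)
  am-gm-ordered {a} {b} a≤b = subst (λ c → 4 * (a * c) ≤ (a + c) * (a + c)) (m+[n∸m]≡n a≤b)
                                (≤-trans (m≤m+n _ _) (≤-reflexive (expand a (b ∸ a))))
    where
    expand : ∀ a e → 4 * (a * (a + e)) + e * e ≡ (a + (a + e)) * (a + (a + e))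
    expand = solve-∀

  am-gm : ∀ a b → 4 * (a * b) ≤ (a + b) * (a + b)
  am-gm a b with ≤-total a b
  ... | inj₁ a≤b = am-gm-ordered a≤b
  ... | inj₂ b≤a = subst₂ (λ p q → 4 * p ≤ q * q) (*-comm b a) (+-comm b a) (am-gm-ordered b≤a)

  cross-term-bound : ∀ a b u v U V → a * a ≤ u * v → b * b ≤ U * V → 2 * (a * b) ≤ u * V + U * v
  cross-term-bound a b u v U V a²≤uv b²≤UV = square-cancel _ _ (begin
    2 * (a * b) * (2 * (a * b))        ≡⟨ regroup₁ a b ⟩
    4 * ((a * a) * (b * b))            ≤⟨ *-monoʳ-≤ 4 (*-mono-≤ a²≤uv b²≤UV) ⟩
    4 * ((u * v) * (U * V))            ≡⟨ regroup₂ u v U V ⟩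
    4 * ((u * V) * (U * v))            ≤⟨ am-gm (u * V) (U * v) ⟩
    (u * V + U * v) * (u * V + U * v)  ∎)
    where
    open ≤-Reasoning
    regroup₁ : ∀ a b → 2 * (a * b) * (2 * (a * b)) ≡ 4 * ((a * a) * (b * b))
    regroup₁ = solve-∀
    regroup₂ : ∀ u v U V → 4 * ((u * v) * (U * V)) ≡ 4 * ((u * V) * (U * v))
    regroup₂ = solve-∀

  cauchy-schwarz : ∀ {X : Set} (L : List X) (x u v : X → ℕ) → (∀ i → x i * x i ≤ u i * v i) →
    ∑ L x * ∑ L x ≤ ∑ L u * ∑ L v
  cauchy-schwarz []      x u v x²≤uv = z≤n
  cauchy-schwarz (i ∷ L) x u v x²≤uv = begin
    (a + b) * (a + b)                        ≡⟨ expand a b ⟩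
    a * a + 2 * (a * b) + b * b              ≤⟨ +-mono-≤ (+-mono-≤ (x²≤uv i) cross) ih ⟩
    u i * v i + (u i * V + U * v i) + U * V  ≡⟨ factor (u i) (v i) U V ⟩
    (u i + U) * (v i + V)                    ∎
    where
    open ≤-Reasoning
    a = x i
    b = ∑ L x
    U = ∑ L u
    V = ∑ L v
    ih : b * b ≤ U * V
    ih = cauchy-schwarz L x u v x²≤uv
    cross : 2 * (a * b) ≤ u i * V + U * v i
    cross = cross-term-bound a b (u i) (v i) U V (x²≤uv i) ih
    expand : ∀ a b → (a + b) * (a + b) ≡ a * a + 2 * (a * b) + b * b
    expand = solve-∀
    factor : ∀ u v U V → u * v + (u * V + U * v) + U * V ≡ (u + U) * (v + V)
    factor = solve-∀

open CauchySchwarz using (cauchy-schwarz)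

∑-pow-log-convex : ∀ {X : Set} (L : List X) (f : X → ℕ) k →
  ∑ L (λ x → f x ^ suc k) * ∑ L (λ x → f x ^ suc k) ≤ ∑ L (λ x → f x ^ k) * ∑ L (λ x → f x ^ (2 + k))
∑-pow-log-convex L f k =
  cauchy-schwarz L (λ x → f x ^ suc k) (λ x → f x ^ k) (λ x → f x ^ (2 + k))
    (λ x → ≤-reflexive (regroup (f x) (f x ^ k)))
  where
  regroup : ∀ r p → (r * p) * (r * p) ≡ p * (r * (r * p))
  regroup = solve-∀

∑ᵗ : {X : Set} → ℕ → List X → (List X → ℕ) → ℕ
∑ᵗ zero    L f = f []
∑ᵗ (suc k) L f = ∑ L (λ x → ∑ᵗ k L (λ T → f (x ∷ T)))

∏ : {X : Set} → List X → (X → ℕ) → ℕ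
∏ []      g = 1
∏ (x ∷ T) g = g x * ∏ T g

module _ {X : Set} where

  ∑ᵗ-cong : ∀ k (L : List X) {f g : List X → ℕ} → f ≗ g → ∑ᵗ k L f ≡ ∑ᵗ k L g
  ∑ᵗ-cong zero    L f≗g = f≗g []
  ∑ᵗ-cong (suc k) L f≗g = ∑-cong L (λ x → ∑ᵗ-cong k L (λ T → f≗g (x ∷ T)))

  ∑ᵗ-mono : ∀ k (L : List X) {f g : List X → ℕ} → (∀ T → length T ≡ k → f T ≤ g T) →
    ∑ᵗ k L f ≤ ∑ᵗ k L g
  ∑ᵗ-mono zero    L f≤g = f≤g [] refl
  ∑ᵗ-mono (suc k) L f≤g = ∑-mono L (λ x → ∑ᵗ-mono k L (λ T |T|≡k → f≤g (x ∷ T) (cong suc |T|≡k)))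

  ∑ᵗ-distrib-+ : ∀ k (L : List X) (f g : List X → ℕ) →
    ∑ᵗ k L (λ T → f T + g T) ≡ ∑ᵗ k L f + ∑ᵗ k L g
  ∑ᵗ-distrib-+ zero    L f g = refl
  ∑ᵗ-distrib-+ (suc k) L f g = trans (∑-cong L (λ x → ∑ᵗ-distrib-+ k L _ _)) (∑-distrib-+ L _ _)

  ∑ᵗ-*ˡ : ∀ k (L : List X) c (f : List X → ℕ) → ∑ᵗ k L (λ T → c * f T) ≡ c * ∑ᵗ k L f
  ∑ᵗ-*ˡ zero    L c f = refl
  ∑ᵗ-*ˡ (suc k) L c f = trans (∑-cong L (λ x → ∑ᵗ-*ˡ k L c _)) (∑-*ˡ L c _)

  ∑ᵗ-const : ∀ k (L : List X) c → ∑ᵗ k L (λ _ → c) ≡ length L ^ k * c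
  ∑ᵗ-const zero    L c = sym (+-identityʳ c)
  ∑ᵗ-const (suc k) L c = begin
    ∑ L (λ _ → ∑ᵗ k L (λ _ → c))  ≡⟨ ∑-cong L (λ _ → ∑ᵗ-const k L c) ⟩
    ∑ L (λ _ → length L ^ k * c)   ≡⟨ ∑-const L _ ⟩
    length L * (length L ^ k * c)  ≡⟨ *-assoc (length L) _ c ⟨
    length L ^ suc k * c           ∎
    where open ≡-Reasoning

  ∑-∑ᵗ-comm : ∀ {Y : Set} k (L : List X) (M : List Y) (f : Y → List X → ℕ) →
    ∑ M (λ y → ∑ᵗ k L (f y)) ≡ ∑ᵗ k L (λ T → ∑ M (λ y → f y T))
  ∑-∑ᵗ-comm zero    L M f = refl
  ∑-∑ᵗ-comm (suc k) L M f = trans (∑-comm M L _) (∑-cong L (λ x → ∑-∑ᵗ-comm k L M _))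

  ∑ᵗ-∏ : ∀ k (L : List X) (g : X → ℕ) → ∑ᵗ k L (λ T → ∏ T g) ≡ ∑ L g ^ k
  ∑ᵗ-∏ zero    L g = refl
  ∑ᵗ-∏ (suc k) L g = begin
    ∑ L (λ x → ∑ᵗ k L (λ T → g x * ∏ T g))  ≡⟨ ∑-cong L (λ x → ∑ᵗ-*ˡ k L (g x) _) ⟩
    ∑ L (λ x → g x * ∑ᵗ k L (λ T → ∏ T g))  ≡⟨ ∑-cong L (λ x → cong (g x *_) (∑ᵗ-∏ k L g)) ⟩
    ∑ L (λ x → g x * ∑ L g ^ k)             ≡⟨ ∑-*ʳ L _ g ⟩
    ∑ L g ^ suc k                           ∎
    where open ≡-Reasoning

∏-⟦⟧≡⟦all?⟧ : ∀ {P : ℤ → Set} (P? : Decidable P) T →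
  ∏ T (λ x → ⟦ does (P? x) ⟧) ≡ ⟦ does (all? P? T) ⟧
∏-⟦⟧≡⟦all?⟧ P? []      = refl
∏-⟦⟧≡⟦all?⟧ P? (x ∷ T) =
  trans (cong (⟦ does (P? x) ⟧ *_) (∏-⟦⟧≡⟦all?⟧ P? T)) (sym (⟦∧⟧≡⟦⟧*⟦⟧ (does (P? x)) _))

count-≡≤1 : ∀ (L : List ℤ) {f : ℤ → ℤ} → Injective _≡_ _≡_ f → Unique L → ∀ m →
  ∑ L (λ y → ⟦ does (f y ℤ.≟ m) ⟧) ≤ 1
count-≡≤1 []      f-inj _              m = z≤n
count-≡≤1 (y ∷ L) {f} f-inj (y∉L ∷ uL) m with f y ℤ.≟ m
... | yes fy≡m = ≤-reflexive (cong suc (trans (∑-cong-All (All.map none y∉L)) (∑-zero L)))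
  where
  none : ∀ {z} → ¬ y ≡ z → ⟦ does (f z ℤ.≟ m) ⟧ ≡ 0
  none {z} y≢z with f z ℤ.≟ m
  ... | yes fz≡m = ⊥-elim (y≢z (f-inj (trans fy≡m (sym fz≡m))))
  ... | no  _    = refl
... | no _ = count-≡≤1 L f-inj uL m

count-∈≤length : ∀ (L : List ℤ) {f : ℤ → ℤ} → Injective _≡_ _≡_ f → Unique L → ∀ M →
  ∑ L (λ y → ⟦ does (f y ∈? M) ⟧) ≤ length M
count-∈≤length L     f-inj uL []      = ≤-reflexive (∑-zero L)
count-∈≤length L {f} f-inj uL (m ∷ M) = begin
  ∑ L (λ y → ⟦ does (f y ℤ.≟ m) ∨ does (f y ∈? M) ⟧)
    ≤⟨ ∑-mono L (λ y → ⟦∨⟧≤⟦⟧+⟦⟧ (does (f y ℤ.≟ m)) _) ⟩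
  ∑ L (λ y → ⟦ does (f y ℤ.≟ m) ⟧ + ⟦ does (f y ∈? M) ⟧)
    ≡⟨ ∑-distrib-+ L _ _ ⟩
  ∑ L (λ y → ⟦ does (f y ℤ.≟ m) ⟧) + ∑ L (λ y → ⟦ does (f y ∈? M) ⟧)
    ≤⟨ +-mono-≤ (count-≡≤1 L f-inj uL m) (count-∈≤length L f-inj uL M) ⟩
  suc (length M) ∎
  where open ≤-Reasoning

distinct-witnesses : ∀ {P : ℤ → Set} (P? : Decidable P) (L : List ℤ) → Unique L →
  ∀ k → k ≤ ∑ L (λ x → ⟦ does (P? x) ⟧) →
  Σ (Fin k → ℤ) λ h → Injective _≡_ _≡_ h × (∀ i → h i ∈ L × P (h i))
distinct-witnesses P? L       uL         zero    _ = (λ ()) , (λ { {()} }) , (λ ())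
distinct-witnesses P? []      uL         (suc k) ()
distinct-witnesses {P} P? (x ∷ L) (x∉L ∷ uL) (suc k) k<count with P? x
... | no _ = let h , h-inj , h-ok = distinct-witnesses P? L uL (suc k) k<count in
             h , h-inj , λ i → there (proj₁ (h-ok i)) , proj₂ (h-ok i)
... | yes Px with distinct-witnesses P? L uL k (s≤s⁻¹ k<count)
...   | h , h-inj , h-ok = x∷h , x∷h-inj , x∷h-ok
  where
  x∷h : Fin (suc k) → ℤ
  x∷h zero    = x
  x∷h (suc i) = h i
  x∷h-inj : Injective _≡_ _≡_ x∷h
  x∷h-inj {zero}  {zero}  _    = refl
  x∷h-inj {zero}  {suc j} x≡hj = ⊥-elim (All.lookup x∉L (proj₁ (h-ok j)) x≡hj)
  x∷h-inj {suc i} {zero}  hi≡x = ⊥-elim (All.lookup x∉L (proj₁ (h-ok i)) (sym hi≡x))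
  x∷h-inj {suc i} {suc j} hi≡hj = cong suc (h-inj hi≡hj)
  x∷h-ok : ∀ i → x∷h i ∈ (x ∷ L) × P (x∷h i)
  x∷h-ok zero    = here refl , Px
  x∷h-ok (suc i) = there (proj₁ (h-ok i)) , proj₂ (h-ok i)

sub-cancelˡ-≡ : ∀ y {a b} → y - a ≡ y - b → a ≡ b
sub-cancelˡ-≡ y {a} {b} eq = begin
  a            ≡⟨ y-[y-a]≡a y a ⟨
  y - (y - a)  ≡⟨ cong (y -_) eq ⟩
  y - (y - b)  ≡⟨ y-[y-a]≡a y b ⟩
  b            ∎
  where
  open ≡-Reasoning
  y-[y-a]≡a : ∀ y a → y - (y - a) ≡ a
  y-[y-a]≡a = ℤ-Solver.solve-∀

sub-cancelʳ-≡ : ∀ n {a b} → a - n ≡ b - n → a ≡ b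
sub-cancelʳ-≡ n {a} {b} eq = begin
  a                ≡⟨ [a-n]+n≡a a n ⟨
  (a - n) ℤ.+ n    ≡⟨ cong (ℤ._+ n) eq ⟩
  (b - n) ℤ.+ n    ≡⟨ [a-n]+n≡a b n ⟩
  b                ∎
  where
  open ≡-Reasoning
  [a-n]+n≡a : ∀ a n → (a - n) ℤ.+ n ≡ a
  [a-n]+n≡a = ℤ-Solver.solve-∀

symRange-unique : ∀ N → Unique (symRange N)
symRange-unique N = Uniqueₚ.map⁺ (λ eq → ℤₚ.+-injective (sub-cancelʳ-≡ (ℤ.+ N) eq)) (Uniqueₚ.upTo⁺ _)

𝟙-shift : List ℤ → ℤ → ℤ → ℕ
𝟙-shift A d x = 𝟙 A (x - d)

repr : List ℤ → ℤ → ℕ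
repr A d = ∑ A (𝟙-shift A d)

energy : List ℤ → List ℤ → ℕ → ℕ
energy D A k = ∑ D (λ d → repr A d ^ k)

conv≡repr : ∀ A d → conv (𝟙 A) (𝟙⁻ A) A d ≡ repr A d
conv≡repr A d = ∑-cong-All (All.tabulate term)
  where
  -[d-y]≡y-d : ∀ d y → ℤ.- (d - y) ≡ y - d
  -[d-y]≡y-d = ℤ-Solver.solve-∀
  term : ∀ {y} → y ∈ A → 𝟙 A y * 𝟙⁻ A (d - y) ≡ 𝟙-shift A d y
  term {y} y∈A with y ∈? A
  ... | yes _   = trans (+-identityʳ _) (cong (𝟙 A) (-[d-y]≡y-d d y))
  ... | no  y∉A = ⊥-elim (y∉A y∈A)

Es≡energy : ∀ s N A → Es s N A ≡ energy (symRange N) A s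
Es≡energy s N A = ∑-cong (symRange N) (λ d → cong (_^ s) (conv≡repr A d))

∑-repr≤length² : ∀ A {D} → Unique D → ∑ D (repr A) ≤ length A * length A
∑-repr≤length² A {D} uD = begin
  ∑ D (λ d → ∑ A (𝟙-shift A d))                   ≡⟨ ∑-comm D A (𝟙-shift A) ⟩
  ∑ A (λ y → ∑ D (λ d → ⟦ does ((y - d) ∈? A) ⟧))  ≤⟨ ∑-mono A (λ y → count-∈≤length D (sub-cancelˡ-≡ y) uD A) ⟩
  ∑ A (λ _ → length A)                            ≡⟨ ∑-const A (length A) ⟩
  length A * length A                             ∎
  where open ≤-Reasoning

energy-suc≤ : ∀ A {D} → Unique D → ∀ k → energy D A (suc k) ≤ length A ^ (2 + k)
energy-suc≤ A {D} uD k = begin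
  ∑ D (λ d → repr A d * repr A d ^ k)  ≤⟨ ∑-mono D (λ d → *-monoʳ-≤ (repr A d) (^-monoˡ-≤ k (repr≤length d))) ⟩
  ∑ D (λ d → repr A d * n ^ k)         ≡⟨ ∑-*ʳ D (n ^ k) (repr A) ⟩
  ∑ D (repr A) * n ^ k                 ≤⟨ *-monoˡ-≤ (n ^ k) (∑-repr≤length² A uD) ⟩
  n * n * n ^ k                        ≡⟨ *-assoc n n (n ^ k) ⟩
  n ^ (2 + k)                          ∎
  where
  open ≤-Reasoning
  n = length A
  repr≤length : ∀ d → repr A d ≤ n
  repr≤length d = ∑-⟦⟧≤length A (λ x → does ((x - d) ∈? A))

KstFree⇒∑-∏-𝟙-shift≤ : ∀ {s t A D} T → KstFree s (suc t) A → Unique D → Unique T → length T ≡ s →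
  ∑ D (λ d → ∏ T (𝟙-shift A d)) ≤ t
KstFree⇒∑-∏-𝟙-shift≤ {s} {t} {A} {D} T kst uD uT |T|≡s with ∑ D (λ d → ∏ T (𝟙-shift A d)) ≤? t
... | yes few  = few
... | no  many = ⊥-elim (kst (x , y , x-inj , y-inj , x+y∈A))
  where
  T⊆A+? : Decidable (λ d → All (λ x → (x - d) ∈ A) T)
  T⊆A+? d = all? (λ x → (x - d) ∈? A) T
  s≤|T| : s ≤ ∑ T (λ _ → 1)
  s≤|T| = ≤-reflexive (sym (trans (trans (∑-const T 1) (*-identityʳ _)) |T|≡s))
  xs = distinct-witnesses (λ _ → yes tt) T uT s s≤|T|
  ds = distinct-witnesses T⊆A+? D uD (suc t)
         (subst (suc t ≤_) (∑-cong D (λ d → ∏-⟦⟧≡⟦all?⟧ (λ x → (x - d) ∈? A) T)) (≰⇒> many))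
  x : Fin s → ℤ
  x = proj₁ xs
  x-inj : Injective _≡_ _≡_ x
  x-inj = proj₁ (proj₂ xs)
  y : Fin (suc t) → ℤ
  y j = ℤ.- proj₁ ds j
  y-inj : Injective _≡_ _≡_ y
  y-inj eq = proj₁ (proj₂ ds) (ℤₚ.neg-injective eq)
  x+y∈A : ∀ i j → (x i ℤ.+ y j) ∈ A
  x+y∈A i j = All.lookup (proj₂ (proj₂ (proj₂ ds) j)) (proj₁ (proj₂ (proj₂ xs) i))

repeats : List ℤ → ℕ
repeats T = ⟦ not (does (unique? T)) ⟧

repeats-∷ : ∀ x T → repeats (x ∷ T) ≤ ⟦ does (x ∈? T) ⟧ + repeats T
repeats-∷ x T = cases (unique? (x ∷ T)) (x ∈? T) (unique? T)
  where
  cases : (u : Dec (Unique (x ∷ T))) (m : Dec (x ∈ T)) (v : Dec (Unique T)) →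
          ⟦ not (does u) ⟧ ≤ ⟦ does m ⟧ + ⟦ not (does v) ⟧
  cases (yes _) _        _        = z≤n
  cases (no _)  (yes _)  _        = s≤s z≤n
  cases (no _)  (no _)   (no _)   = ≤-refl
  cases (no ¬u) (no x∉T) (yes uT) = ⊥-elim (¬u (¬Any⇒All¬ T x∉T ∷ uT))

*-⟦⟧-split : ∀ m b → m ≡ m * ⟦ b ⟧ + m * ⟦ not b ⟧
*-⟦⟧-split m b = begin
  m                          ≡⟨ *-identityʳ m ⟨
  m * 1                      ≡⟨ cong (m *_) (⟦⟧+⟦not⟧≡1 b) ⟨
  m * (⟦ b ⟧ + ⟦ not b ⟧)    ≡⟨ *-distribˡ-+ m ⟦ b ⟧ _ ⟩
  m * ⟦ b ⟧ + m * ⟦ not b ⟧  ∎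
  where open ≡-Reasoning

module _ {A : List ℤ} (uA : Unique A) {g : ℤ → ℕ} (g≤1 : ∀ x → g x ≤ 1) where

  private
    R : ℕ
    R = ∑ A g

    repeated : ℕ → ℕ
    repeated k = ∑ᵗ k A (λ T → ∏ T g * repeats T)

    hit : ℤ → List ℤ → ℕ
    hit x T = g x * ⟦ does (x ∈? T) ⟧

    hits≤length : ∀ T → ∑ A (λ x → hit x T) ≤ length T
    hits≤length T = ≤-trans (∑-mono A (λ x → ≤-trans (*-monoˡ-≤ _ (g≤1 x)) (≤-reflexive (+-identityʳ _))))
                            (count-∈≤length A (λ eq → eq) uA T)

    repeated-suc≤ : ∀ k → repeated (suc k) ≤ R * repeated k + k * R ^ k
    repeated-suc≤ k = begin
      ∑ A (λ x → ∑ᵗ k A (λ T → (g x * ∏ T g) * repeats (x ∷ T)))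
        ≤⟨ ∑-mono A (λ x → ∑ᵗ-mono k A (λ T _ → split x T)) ⟩
      ∑ A (λ x → ∑ᵗ k A (λ T → g x * (∏ T g * repeats T) + ∏ T g * hit x T))
        ≡⟨ ∑-cong A (λ x → ∑ᵗ-distrib-+ k A _ _) ⟩
      ∑ A (λ x → ∑ᵗ k A (λ T → g x * (∏ T g * repeats T)) + ∑ᵗ k A (λ T → ∏ T g * hit x T))
        ≡⟨ ∑-distrib-+ A _ _ ⟩
      ∑ A (λ x → ∑ᵗ k A (λ T → g x * (∏ T g * repeats T))) + ∑ A (λ x → ∑ᵗ k A (λ T → ∏ T g * hit x T))
        ≡⟨ cong₂ _+_ (trans (∑-cong A (λ x → ∑ᵗ-*ˡ k A (g x) _)) (∑-*ʳ A _ g)) (∑-∑ᵗ-comm k A A _) ⟩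
      R * repeated k + ∑ᵗ k A (λ T → ∑ A (λ x → ∏ T g * hit x T))
        ≡⟨ cong (R * repeated k +_) (∑ᵗ-cong k A (λ T → ∑-*ˡ A (∏ T g) _)) ⟩
      R * repeated k + ∑ᵗ k A (λ T → ∏ T g * ∑ A (λ x → hit x T))
        ≤⟨ +-monoʳ-≤ (R * repeated k) (∑ᵗ-mono k A hits≤k) ⟩
      R * repeated k + ∑ᵗ k A (λ T → k * ∏ T g)
        ≡⟨ cong (R * repeated k +_) (trans (∑ᵗ-*ˡ k A k _) (cong (k *_) (∑ᵗ-∏ k A g))) ⟩
      R * repeated k + k * R ^ k ∎
      where
      open ≤-Reasoning
      regroup : ∀ a b i m → (a * b) * (i + m) ≡ a * (b * m) + b * (a * i)
      regroup = solve-∀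
      split : ∀ x T → (g x * ∏ T g) * repeats (x ∷ T) ≤ g x * (∏ T g * repeats T) + ∏ T g * hit x T
      split x T = ≤-trans (*-monoʳ-≤ (g x * ∏ T g) (repeats-∷ x T))
                          (≤-reflexive (regroup (g x) (∏ T g) ⟦ does (x ∈? T) ⟧ (repeats T)))
      hits≤k : ∀ T → length T ≡ k → ∏ T g * ∑ A (λ x → hit x T) ≤ k * ∏ T g
      hits≤k T |T|≡k = ≤-trans (*-monoʳ-≤ (∏ T g) (≤-trans (hits≤length T) (≤-reflexive |T|≡k)))
                               (≤-reflexive (*-comm (∏ T g) k))

  ∑ᵗ-∏-repeats≤ : ∀ k → ∑ᵗ (suc k) A (λ T → ∏ T g * repeats T) ≤ (suc k C 2) * ∑ A g ^ k
  ∑ᵗ-∏-repeats≤ zero    = ≤-trans (repeated-suc≤ 0) (≤-reflexive (trans (+-identityʳ _) (*-zeroʳ R)))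
  ∑ᵗ-∏-repeats≤ (suc k) = begin
    repeated (2 + k)                               ≤⟨ repeated-suc≤ (suc k) ⟩
    R * repeated (suc k) + suc k * R ^ suc k       ≤⟨ +-monoˡ-≤ _ (*-monoʳ-≤ R (∑ᵗ-∏-repeats≤ k)) ⟩
    R * ((suc k C 2) * R ^ k) + suc k * R ^ suc k  ≡⟨ regroup R (suc k C 2) (R ^ k) (suc k) ⟩
    (suc k C 2 + suc k) * R ^ suc k                ≡⟨ cong (_* R ^ suc k) pascal ⟩
    (suc (suc k) C 2) * R ^ suc k                  ∎
    where
    open ≤-Reasoning
    regroup : ∀ r b p k → r * (b * p) + k * (r * p) ≡ (b + k) * (r * p)
    regroup = solve-∀
    pascal : suc k C 2 + suc k ≡ suc (suc k) C 2
    pascal = begin-equality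
      suc k C 2 + suc k      ≡⟨ +-comm _ (suc k) ⟩
      suc k + suc k C 2      ≡⟨ cong (_+ suc k C 2) (nC1≡n (suc k)) ⟨
      suc k C 1 + suc k C 2  ≡⟨ nCk+nC[k+1]≡[n+1]C[k+1] (suc k) 1 ⟩
      suc (suc k) C 2        ∎

energy-recurrence : ∀ {s t A D} → Unique A → Unique D → KstFree (suc s) (suc t) A →
  energy D A (suc s) ≤ length A ^ suc s * t + (suc s C 2) * energy D A s
energy-recurrence {s} {t} {A} {D} uA uD kst = begin
  ∑ D (λ d → repr A d ^ suc s)                       ≡⟨ ∑-cong D split ⟩
  ∑ D (λ d → distinctPart d + repeatedPart d)        ≡⟨ ∑-distrib-+ D distinctPart repeatedPart ⟩
  ∑ D distinctPart + ∑ D repeatedPart                ≤⟨ +-mono-≤ distinct≤ repeated≤ ⟩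
  length A ^ suc s * t + (suc s C 2) * energy D A s  ∎
  where
  open ≤-Reasoning
  distinctTerm repeatedTerm : ℤ → List ℤ → ℕ
  distinctTerm d T = ∏ T (𝟙-shift A d) * ⟦ does (unique? T) ⟧
  repeatedTerm d T = ∏ T (𝟙-shift A d) * repeats T

  distinctPart repeatedPart : ℤ → ℕ
  distinctPart d = ∑ᵗ (suc s) A (distinctTerm d)
  repeatedPart d = ∑ᵗ (suc s) A (repeatedTerm d)

  split : ∀ d → repr A d ^ suc s ≡ distinctPart d + repeatedPart d
  split d = begin-equality
    repr A d ^ suc s
      ≡⟨ ∑ᵗ-∏ (suc s) A (𝟙-shift A d) ⟨
    ∑ᵗ (suc s) A (λ T → ∏ T (𝟙-shift A d))
      ≡⟨ ∑ᵗ-cong (suc s) A (λ T → *-⟦⟧-split (∏ T (𝟙-shift A d)) (does (unique? T))) ⟩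
    ∑ᵗ (suc s) A (λ T → distinctTerm d T + repeatedTerm d T)
      ≡⟨ ∑ᵗ-distrib-+ (suc s) A (distinctTerm d) (repeatedTerm d) ⟩
    distinctPart d + repeatedPart d ∎

  few-translates : ∀ T → length T ≡ suc s → ∑ D (λ d → ∏ T (𝟙-shift A d)) * ⟦ does (unique? T) ⟧ ≤ t
  few-translates T |T|≡s with unique? T
  ... | yes uT = ≤-trans (≤-reflexive (*-identityʳ _)) (KstFree⇒∑-∏-𝟙-shift≤ T kst uD uT |T|≡s)
  ... | no  _  = ≤-trans (≤-reflexive (*-zeroʳ (∑ D (λ d → ∏ T (𝟙-shift A d))))) z≤n

  distinct≤ : ∑ D distinctPart ≤ length A ^ suc s * t
  distinct≤ = begin
    ∑ D distinctPart
      ≡⟨ ∑-∑ᵗ-comm (suc s) A D distinctTerm ⟩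
    ∑ᵗ (suc s) A (λ T → ∑ D (λ d → distinctTerm d T))
      ≡⟨ ∑ᵗ-cong (suc s) A (λ T → ∑-*ʳ D ⟦ does (unique? T) ⟧ (λ d → ∏ T (𝟙-shift A d))) ⟩
    ∑ᵗ (suc s) A (λ T → ∑ D (λ d → ∏ T (𝟙-shift A d)) * ⟦ does (unique? T) ⟧)
      ≤⟨ ∑ᵗ-mono (suc s) A few-translates ⟩
    ∑ᵗ (suc s) A (λ _ → t)
      ≡⟨ ∑ᵗ-const (suc s) A t ⟩
    length A ^ suc s * t ∎

  repeated≤ : ∑ D repeatedPart ≤ (suc s C 2) * energy D A s
  repeated≤ = ≤-trans (∑-mono D (λ d → ∑ᵗ-∏-repeats≤ uA (λ x → ⟦⟧≤1 (does ((x - d) ∈? A))) s))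
                      (≤-reflexive (∑-*ˡ D (suc s C 2) (λ d → repr A d ^ s)))

excess-constant : ℕ → ℕ → ℕ
excess-constant s t = suc ((s C 2) * (s C 2) * (t + s C 2))

module _ (N : ℕ) {A : List ℤ} (uA : Unique A) where

  private
    n : ℕ
    n = length A

    ℰ : ℕ → ℕ
    ℰ = energy (symRange N) A

    uD : Unique (symRange N)
    uD = symRange-unique N

  Es₂≤ : ∀ t → KstFree 2 (suc t) A → Es 2 N A ≤ suc t * n ^ 2
  Es₂≤ t kst = begin
    Es 2 N A               ≡⟨ Es≡energy 2 N A ⟩
    ℰ 2                    ≤⟨ energy-recurrence uA uD kst ⟩
    n ^ 2 * t + 1 * ℰ 1    ≤⟨ +-monoʳ-≤ (n ^ 2 * t) (*-monoʳ-≤ 1 (energy-suc≤ A uD 0)) ⟩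
    n ^ 2 * t + 1 * n ^ 2  ≡⟨ regroup (n ^ 2) t ⟩
    suc t * n ^ 2          ∎
    where
    open ≤-Reasoning
    regroup : ∀ x t → x * t + 1 * x ≡ suc t * x
    regroup = solve-∀

  excess²≤ : ∀ m t → KstFree (3 + m) (suc t) A →
    (Es (3 + m) N A ∸ suc t * n ^ (3 + m)) ^ 2 ≤ excess-constant (3 + m) t ^ 2 * n ^ (5 + m * 2)
  excess²≤ m t kst = begin
    X * (X * 1)                              ≤⟨ *-mono-≤ X≤Bℰₛ₋₁ (*-monoˡ-≤ 1 X≤Bℰₛ₋₁) ⟩
    (B * ℰ (2 + m)) * ((B * ℰ (2 + m)) * 1)  ≡⟨ regroup₁ B (ℰ (2 + m)) ⟩
    B * B * (ℰ (2 + m) * ℰ (2 + m))          ≤⟨ *-monoʳ-≤ (B * B) ℰₛ₋₁²≤ ⟩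
    B * B * (K * n ^ (5 + m * 2))            ≡⟨ *-assoc (B * B) K _ ⟨
    B * B * K * n ^ (5 + m * 2)              ≤⟨ *-monoˡ-≤ (n ^ (5 + m * 2)) B²K≤C² ⟩
    C ^ 2 * n ^ (5 + m * 2)                  ∎
    where
    open ≤-Reasoning
    s = 3 + m
    B = s C 2
    K = t + B
    C = excess-constant s t
    X = Es s N A ∸ suc t * n ^ s

    regroup₁ : ∀ b e → (b * e) * ((b * e) * 1) ≡ b * b * (e * e)
    regroup₁ = solve-∀
    regroup₂ : ∀ x t b → x * t + b * x ≡ (t + b) * x
    regroup₂ = solve-∀

    recurrence : ℰ s ≤ n ^ s * t + B * ℰ (2 + m)
    recurrence = energy-recurrence uA uD kst

    X≤Bℰₛ₋₁ : X ≤ B * ℰ (2 + m)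
    X≤Bℰₛ₋₁ = m≤n+o⇒m∸n≤o _ _ (begin
      Es s N A                       ≡⟨ Es≡energy s N A ⟩
      ℰ s                            ≤⟨ recurrence ⟩
      n ^ s * t + B * ℰ (2 + m)      ≤⟨ +-monoˡ-≤ _ (≤-trans (≤-reflexive (*-comm (n ^ s) t)) (m≤n+m _ _)) ⟩
      suc t * n ^ s + B * ℰ (2 + m)  ∎)

    ℰₛ≤ : ℰ s ≤ K * n ^ s
    ℰₛ≤ = begin
      ℰ s                        ≤⟨ recurrence ⟩
      n ^ s * t + B * ℰ (2 + m)  ≤⟨ +-monoʳ-≤ (n ^ s * t) (*-monoʳ-≤ B (energy-suc≤ A uD (suc m))) ⟩
      n ^ s * t + B * n ^ s      ≡⟨ regroup₂ (n ^ s) t B ⟩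
      K * n ^ s                  ∎

    ℰₛ₋₁²≤ : ℰ (2 + m) * ℰ (2 + m) ≤ K * n ^ (5 + m * 2)
    ℰₛ₋₁²≤ = begin
      ℰ (2 + m) * ℰ (2 + m)          ≤⟨ ∑-pow-log-convex (symRange N) (repr A) (suc m) ⟩
      ℰ (1 + m) * ℰ s                ≤⟨ *-mono-≤ (energy-suc≤ A uD m) ℰₛ≤ ⟩
      n ^ (2 + m) * (K * n ^ s)      ≡⟨ x*[k*y]≡k*[x*y] (n ^ (2 + m)) K (n ^ s) ⟩
      K * (n ^ (2 + m) * n ^ s)      ≡⟨ cong (K *_) (^-distribˡ-+-* n (2 + m) s) ⟨
      K * n ^ ((2 + m) + s)          ≡⟨ cong (λ e → K * n ^ e) (exponent m) ⟩
      K * n ^ (5 + m * 2)            ∎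
      where
      x*[k*y]≡k*[x*y] : ∀ x k y → x * (k * y) ≡ k * (x * y)
      x*[k*y]≡k*[x*y] = solve-∀
      exponent : ∀ m → (2 + m) + (3 + m) ≡ 5 + m * 2
      exponent = solve-∀

    B²K≤C² : B * B * K ≤ C ^ 2
    B²K≤C² = ≤-trans (n≤1+n _) (≤-trans (≤-reflexive (sym (*-identityʳ C))) (m≤m+n (C * 1) _))

lemma2p2 : (s : ℕ) → 2 ≤ s →
    Σ ℕ λ p → Σ ℕ λ q → (0 < p) × (p ≤ q) ×
    ((t : ℕ) → s ≤ t →
      Σ ℕ λ C → (0 < C) ×
      ((N : ℕ) → 1 ≤ N → (A : List ℤ) → SubsetOfInterval N A → KstFree s t A →
        (Es s N A ∸ t * length A ^ s) ^ q ≤ C ^ q * length A ^ (s * q ∸ p)))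
lemma2p2 (suc zero) (s≤s ())
lemma2p2 (suc (suc zero)) _ = 1 , 2 , s≤s z≤n , s≤s z≤n , λ where
  (suc t) _ → 1 , s≤s z≤n , λ N _ A (uA , _) kst →
    subst (λ x → x ^ 2 ≤ 1 ^ 2 * length A ^ 3) (sym (m≤n⇒m∸n≡0 (Es₂≤ N uA t kst))) z≤n
lemma2p2 (suc (suc (suc m))) _ = 1 , 2 , s≤s z≤n , s≤s z≤n , λ where
  (suc t) _ → excess-constant (3 + m) t , s≤s z≤n , λ N _ A (uA , _) kst → excess²≤ N uA m t kst
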